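{- Let $d>1$ be square-free, $K=\mathbb Q(\sqrt d)\subset\mathbb R$, and let $\xi\in\varphi(\mathcal N)$ with $\xi=\varphi(\pi(\alpha))$ for some $\alpha\in\mathcal V$. Then $$M(\xi)=\frac{\sqrt d\,|N(\alpha)|}{\gcd(N(\alpha),d)}.$$
   Context: $\mathcal O=\mathbb Z\oplus\omega\mathbb Z$ with $\omega=\sqrt d$ if $d\equiv2,3\pmod4$, $\omega=(1+\sqrt d)/2$ if $d\equiv1\pmod4$; conjugation $\sqrt d\mapsto-\sqrt d$, $N(\beta)=\beta\overline\beta$. $\mathcal N=\{\beta\in K:N(\beta)=1\}$; $\epsilon$ a fundamental unit; $\varphi(\beta)=\log|\beta|\bmod\log|\epsilon^2|\in\mathbb R/(\log|\epsilon^2|)\mathbb Z$; $\pi(z)=z/\overline z$. $\mathcal V=\{a+b\omega:a,b\in\mathbb Z,\gcd(a,b)=1\}$. For nonzero $\gamma,\gamma'\in\mathcal O$, $\gamma\sim\gamma'$ iff there are a unit $\upsilon$ and positive integers $m,n$ with $\upsilon m\gamma'=n\gamma$. For $\xi\in\varphi(\mathcal N)$, the visible points $\alpha$ with $\varphi(\pi(\alpha))=\xi$ form exactly two $\sim$-classes, on each of which $|N|$ is constant; $M(\xi)=\sqrt{|N(\alpha)N(\alpha')|}$ for representatives $\alpha,\alpha'$ of the two classes. -}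

module Defs where

open import Data.Nat as ℕ using (ℕ; _%_; _/_; _∸_)
open import Data.Nat.Divisibility using (_∣_)
open import Data.Nat.GCD using (gcd)
open import Data.Integer as ℤ using (ℤ; +_; -_; ∣_∣)
open import Data.Product using (_×_; _,_; Σ; ∃; ∃-syntax)
open import Data.Sum using (_⊎_)
open import Relation.Binary.PropositionalEquality using (_≡_)
open import Relation.Nullary using (¬_)

SquareFree : ℕ → Set
SquareFree d = ∀ (p : ℕ) → (p ℕ.* p) ∣ d → p ≡ 1

-- ω satisfies ω² = t·ω + n  with
--   d ≡ 2,3 (mod 4):  ω = √d,          t = 0, n = d
--   d ≡ 1   (mod 4):  ω = (1+√d)/2,    t = 1, n = (d-1)/4
-- and its conjugate is  ω̄ = t - ω.
traceω : ℕ → ℤ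
traceω d with d % 4
... | 1 = + 1
... | _ = + 0

normω : ℕ → ℤ
normω d with d % 4
... | 1 = + ((d ∸ 1) / 4)
... | _ = + d

-- an element a + bω of 𝒪 = ℤ ⊕ ωℤ, stored as its coordinates (a , b)
𝒪 : Set
𝒪 = ℤ × ℤ

ι : ℤ → 𝒪
ι m = (m , + 0)

mul : ℕ → 𝒪 → 𝒪 → 𝒪
mul d (a , b) (c , e) =
  (a ℤ.* c ℤ.+ b ℤ.* e ℤ.* normω d ,
   a ℤ.* e ℤ.+ b ℤ.* c ℤ.+ b ℤ.* e ℤ.* traceω d)

conj : ℕ → 𝒪 → 𝒪
conj d (a , b) = (a ℤ.+ b ℤ.* traceω d , ℤ.- b)

-- N(a + bω) = (a+bω)(a+bω̄) = a² + t a b - n b²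
N : ℕ → 𝒪 → ℤ
N d (a , b) = a ℤ.* a ℤ.+ traceω d ℤ.* a ℤ.* b ℤ.- normω d ℤ.* b ℤ.* b

IsUnit : ℕ → 𝒪 → Set
IsUnit d υ = ∣ N d υ ∣ ≡ 1

Visible : 𝒪 → Set
Visible (a , b) = gcd (∣ a ∣) (∣ b ∣) ≡ 1

Equiv : ℕ → 𝒪 → 𝒪 → Set
Equiv d γ γ' =
  Σ 𝒪 λ υ → Σ ℕ λ m → Σ ℕ λ n →
    IsUnit d υ × ℕ.NonZero m × ℕ.NonZero n ×
    (mul d υ (mul d (ι (+ m)) γ') ≡ mul d (ι (+ n)) γ)

-- φ(π(α)) = φ(π(α')), stated algebraically:
-- π(α)/π(α') = ± ε^{2k} for some k ∈ ℤ, i.e. α ᾱ' = ± u² ᾱ α' for a unit u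
-- (every unit is ± ε^j, so u² ranges exactly over the ε^{2k}).
SamePhi : ℕ → 𝒪 → 𝒪 → Set
SamePhi d α α' =
  Σ 𝒪 λ u → Σ ℤ λ s →
    IsUnit d u × (s ≡ + 1 ⊎ s ≡ - (+ 1)) ×
    (mul d α (conj d α') ≡
       mul d (ι s) (mul d (mul d u u) (mul d (conj d α) α')))

-- α' is a representative of the "other" ∼-class on the fibre of φ∘π through α
OtherClass : ℕ → 𝒪 → 𝒪 → Set
OtherClass d α α' = Visible α' × SamePhi d α α' × ¬ Equiv d α α'

{-# OPTIONS --safe #-}
module Submission where

-- Let r ∈ 𝒪 be a square root of d (r = ω if d ≢ 1 mod 4, r = 2ω − 1 if d ≡ 1 mod 4) and
-- g = gcd(N α, d).  For visible α the content of rα is exactly g, so α₀ = rα / g is visible;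
-- it satisfies α ᾱ₀ = − ᾱ α₀, hence lies over the same ξ, and N α₀ = − d N α / g² shows
-- that α₀ ≁ α because d is not a square.  Conversely, if α′ lies over ξ, say
-- α ᾱ′ = ± u² ᾱ α′, then δ = ᾱ α′ u is either fixed by conjugation, which would make
-- α′ ∼ α, or negated by it; then δ = c r and N(α) α′ u = c r α.  Comparing contents gives
-- |N α| = |c| g and comparing norms gives |N α| |N α′| = c² d, so |N α N α′| = d N(α)² / g².

open import Defs
open import Algebra.Bundles using (CommutativeSemigroup)
open import Algebra.Structures using (IsCommutativeSemigroup)
import Algebra.Properties.CommutativeSemigroup as CommutativeSemigroupProperties
open import Data.Nat.Base as ℕ using (ℕ; suc)
import Data.Nat.Properties as ℕₚ
open import Data.Nat.Coprimality using (Coprime; coprime-/gcd; coprime-divisor)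
open import Data.Nat.Divisibility as ℕ∣
  using (_∣_; divides; ∣-refl; ∣-trans; ∣1⇒≡1; 1∣_; *-cancelʳ-∣; *-monoʳ-∣; *-pres-∣; m%n≡0⇒n∣m)
open import Data.Nat.DivMod using (_%_; _/_; m/n*n≡m; m≡m%n+[m/n]*n; m*n/n≡m)
open import Data.Nat.GCD
  using (gcd; gcd[m,n]∣m; gcd[m,n]∣n; gcd[m,n]≢0; gcd-greatest; gcd-identityˡ; c*gcd[m,n]≡gcd[cm,cn])
import Data.Nat.Tactic.RingSolver as ℕ-Solver
open import Data.Integer.Base as ℤ using (ℤ; +_; -_; ∣_∣; 0ℤ; 1ℤ; -1ℤ; +0; +[1+_]; -[1+_])
import Data.Integer.Properties as ℤₚ
open import Data.Integer.Divisibility.Signed as ℤ∣ using (divides) renaming (_∣_ to _∣ℤ_)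
import Data.Integer.Tactic.RingSolver as ℤ-Solver
open import Data.List.Base using (_∷_; [])
open import Data.Product.Base using (Σ; ∃-syntax; ∃₂; _×_; _,_; proj₁; proj₂)
open import Data.Sum.Base using (_⊎_; inj₁; inj₂)
open import Data.Empty using (⊥; ⊥-elim)
open import Relation.Nullary.Negation using (¬_)
open import Relation.Binary.PropositionalEquality

module _ where

  open import Data.Nat.Base using (_*_; _<_; NonZero; ≢-nonZero)
  open ℕ-Solver using (solve)

  NonSquare : ℕ → Set
  NonSquare d = ∀ m n → m ≢ 0 → m * m * d ≢ n * n

  coprime-quotients : ∀ m n → m ≢ 0 →
    ∃₂ λ m′ n′ → ∃₂ λ e (_ : NonZero e) → m ≡ m′ * e × n ≡ n′ * e × Coprime m′ n′
  coprime-quotients m n m≢0 =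
    m / e , n / e , e , e≢0 , sym (m/n*n≡m (gcd[m,n]∣m m n)) , sym (m/n*n≡m (gcd[m,n]∣n m n)) , coprime-/gcd m n
    where
    e : ℕ
    e = gcd m n
    instance
      e≢0 : NonZero e
      e≢0 = ≢-nonZero (gcd[m,n]≢0 m n (inj₁ m≢0))

  squareFree∧∣⇒≢0 : ∀ {d g} → SquareFree d → g ∣ d → g ≢ 0
  squareFree∧∣⇒≢0 sf 0∣d refl with sf 2 (∣-trans (divides 0 refl) 0∣d)
  ... | ()

  squareFree-∣-square⇒∣ : ∀ {d g a} → SquareFree d → g ∣ d → g ∣ a * a → g ∣ a
  squareFree-∣-square⇒∣ {g = g} {a} sf g∣d g∣a² with coprime-quotients g a (squareFree∧∣⇒≢0 sf g∣d)
  ... | g′ , a′ , e , e≢0 , refl , refl , cop = *-pres-∣ g′∣a′ (∣-refl {e})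
    where
    g′∣a′a′e : g′ ∣ a′ * (a′ * e)
    g′∣a′a′e = *-cancelʳ-∣ e {{e≢0}} (subst (g′ * e ∣_) reorder g∣a²)
      where
      reorder : a′ * e * (a′ * e) ≡ a′ * (a′ * e) * e
      reorder = solve (a′ ∷ e ∷ [])
    g′≡1 : g′ ≡ 1
    g′≡1 = sf g′ (∣-trans (*-monoʳ-∣ g′ (coprime-divisor cop (coprime-divisor cop g′∣a′a′e))) g∣d)
    g′∣a′ : g′ ∣ a′
    g′∣a′ = subst (_∣ a′) (sym g′≡1) (1∣ a′)

  squareFree⇒nonSquare : ∀ {d} → SquareFree d → 1 < d → NonSquare d
  squareFree⇒nonSquare {d} sf 1<d m n m≢0 m²d≡n² with coprime-quotients m n m≢0
  ... | m′ , n′ , e , e≢0 , refl , refl , cop = ℕₚ.<⇒≢ 1<d (sym d≡1)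
    where
    m′²d≡n′² : m′ * m′ * d ≡ n′ * n′
    m′²d≡n′² = ℕₚ.*-cancelʳ-≡ _ _ (e * e) {{ℕₚ.m*n≢0 e e {{e≢0}} {{e≢0}}}} (begin
      m′ * m′ * d * (e * e)   ≡⟨ solve (m′ ∷ d ∷ e ∷ []) ⟩
      m′ * e * (m′ * e) * d   ≡⟨ m²d≡n² ⟩
      n′ * e * (n′ * e)       ≡⟨ solve (n′ ∷ e ∷ []) ⟩
      n′ * n′ * (e * e)       ∎)
      where open ≡-Reasoning
    m′≡1 : m′ ≡ 1
    m′≡1 = ∣1⇒≡1 (coprime-divisor cop (coprime-divisor cop m′∣n′n′))
      where
      m′∣n′n′ : m′ ∣ n′ * (n′ * 1)
      m′∣n′n′ = divides (m′ * d) (begin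
        n′ * (n′ * 1) ≡⟨ solve (n′ ∷ []) ⟩
        n′ * n′       ≡⟨ m′²d≡n′² ⟨
        m′ * m′ * d   ≡⟨ solve (m′ ∷ d ∷ []) ⟩
        m′ * d * m′   ∎)
        where open ≡-Reasoning
    d≡n′² : d ≡ n′ * n′
    d≡n′² = trans (sym (ℕₚ.*-identityˡ d)) (subst (λ k → k * k * d ≡ n′ * n′) m′≡1 m′²d≡n′²)
    d≡1 : d ≡ 1
    d≡1 = trans d≡n′² (cong (λ k → k * k) (sf n′ (divides 1 (trans d≡n′² (sym (ℕₚ.*-identityˡ _))))))

  m²b≡n²a∧k²b≡la⇒m²l≡[kn]² : ∀ {a b m n k l} .{{_ : NonZero a}} →
    m * m * b ≡ n * n * a → k * k * b ≡ l * a → m * m * l ≡ k * n * (k * n)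
  m²b≡n²a∧k²b≡la⇒m²l≡[kn]² {a} {b} {m} {n} {k} {l} m²b≡n²a k²b≡la = ℕₚ.*-cancelʳ-≡ _ _ a (begin
    m * m * l * a           ≡⟨ solve (m ∷ l ∷ a ∷ []) ⟩
    m * m * (l * a)         ≡⟨ cong (m * m *_) k²b≡la ⟨
    m * m * (k * k * b)     ≡⟨ solve (m ∷ k ∷ b ∷ []) ⟩
    k * k * (m * m * b)     ≡⟨ cong (k * k *_) m²b≡n²a ⟩
    k * k * (n * n * a)     ≡⟨ solve (k ∷ n ∷ a ∷ []) ⟩
    k * n * (k * n) * a     ∎)
    where open ≡-Reasoning

  m≡kg∧m²n≡k²dm⇒mng²≡dm² : ∀ {m n k g d} .{{_ : NonZero m}} →
    m ≡ k * g → m * m * n ≡ k * k * (d * m) → m * n * (g * g) ≡ d * (m * m)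
  m≡kg∧m²n≡k²dm⇒mng²≡dm² {m} {n} {k} {g} {d} m≡kg m²n≡k²dm = begin
    m * n * (g * g)         ≡⟨ cong (_* (g * g)) mn≡k²d ⟩
    k * k * d * (g * g)     ≡⟨ solve (k ∷ d ∷ g ∷ []) ⟩
    d * (k * g * (k * g))   ≡⟨ cong (λ x → d * (x * x)) m≡kg ⟨
    d * (m * m)             ∎
    where
    open ≡-Reasoning
    mn≡k²d : m * n ≡ k * k * d
    mn≡k²d = ℕₚ.*-cancelˡ-≡ _ _ m (begin
      m * (m * n)             ≡⟨ ℕₚ.*-assoc m m n ⟨
      m * m * n               ≡⟨ m²n≡k²dm ⟩
      k * k * (d * m)         ≡⟨ solve (k ∷ d ∷ m ∷ []) ⟩
      m * (k * k * d)         ∎)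

module _ where

  open import Data.Integer.Base using (_+_; _*_; _-_; NonZero)

  infixr 7 _•_

  _•_ : ℤ → 𝒪 → 𝒪
  k • (a , b) = (k * a , k * b)

  cont : 𝒪 → ℕ
  cont (a , b) = gcd ∣ a ∣ ∣ b ∣

  cont-∣ : ∀ a b → + cont (a , b) ∣ℤ a × + cont (a , b) ∣ℤ b
  cont-∣ a b = ℤ∣.∣ᵤ⇒∣ (gcd[m,n]∣m ∣ a ∣ ∣ b ∣) , ℤ∣.∣ᵤ⇒∣ (gcd[m,n]∣n ∣ a ∣ ∣ b ∣)

  ∣-cont : ∀ {k a b} → + k ∣ℤ a → + k ∣ℤ b → k ∣ cont (a , b)
  ∣-cont k∣a k∣b = gcd-greatest (ℤ∣.∣⇒∣ᵤ k∣a) (ℤ∣.∣⇒∣ᵤ k∣b)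

  cont-• : ∀ k v → cont (k • v) ≡ ∣ k ∣ ℕ.* cont v
  cont-• k (a , b) rewrite ℤₚ.abs-* k a | ℤₚ.abs-* k b =
    sym (c*gcd[m,n]≡gcd[cm,cn] (∣ k ∣) (∣ a ∣) (∣ b ∣))

  •-• : ∀ k l v → k • l • v ≡ (k * l) • v
  •-• k l (a , b) = cong₂ _,_ (sym (ℤₚ.*-assoc k l a)) (sym (ℤₚ.*-assoc k l b))

  •-identityˡ : ∀ v → 1ℤ • v ≡ v
  •-identityˡ (a , b) = cong₂ _,_ (ℤₚ.*-identityˡ a) (ℤₚ.*-identityˡ b)

  •-cancelˡ : ∀ k {v w} .{{_ : NonZero k}} → k • v ≡ k • w → v ≡ w
  •-cancelˡ k eq =
    cong₂ _,_ (ℤₚ.*-cancelˡ-≡ k _ _ (cong proj₁ eq)) (ℤₚ.*-cancelˡ-≡ k _ _ (cong proj₂ eq))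

  primitive-part : ∀ v → cont v ≢ 0 → ∃[ v₀ ] Visible v₀ × v ≡ + cont v • v₀
  primitive-part (a , b) c≢0 with cont-∣ a b
  ... | divides a₀ a≡a₀c , divides b₀ b≡b₀c = (a₀ , b₀) , visible , v≡c•v₀
    where
    v≡c•v₀ : (a , b) ≡ + cont (a , b) • (a₀ , b₀)
    v≡c•v₀ = cong₂ _,_ (trans a≡a₀c (ℤₚ.*-comm a₀ _)) (trans b≡b₀c (ℤₚ.*-comm b₀ _))
    visible : Visible (a₀ , b₀)
    visible = ℕₚ.*-cancelˡ-≡ _ _ (cont (a , b)) {{ℕ.≢-nonZero c≢0}} (begin
      cont (a , b) ℕ.* cont (a₀ , b₀) ≡⟨ cont-• (+ cont (a , b)) (a₀ , b₀) ⟨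
      cont (+ cont (a , b) • (a₀ , b₀)) ≡⟨ cong cont v≡c•v₀ ⟨
      cont (a , b) ≡⟨ ℕₚ.*-identityʳ _ ⟨
      cont (a , b) ℕ.* 1 ∎)
      where open ≡-Reasoning

  cont-•-visible : ∀ k {v} → Visible v → cont (k • v) ≡ ∣ k ∣
  cont-•-visible k {v} v-visible =
    trans (cont-• k v) (trans (cong (∣ k ∣ ℕ.*_) v-visible) (ℕₚ.*-identityʳ ∣ k ∣))

  -i≡i⇒i≡0 : ∀ {i} → - i ≡ i → i ≡ 0ℤ
  -i≡i⇒i≡0 {+0} _ = refl

  ∣i∣≡1⇒i≡±1 : ∀ {i} → ∣ i ∣ ≡ 1 → i ≡ 1ℤ ⊎ i ≡ -1ℤ
  ∣i∣≡1⇒i≡±1 {+[1+ 0 ]} _ = inj₁ refl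
  ∣i∣≡1⇒i≡±1 { -[1+ 0 ]} _ = inj₂ refl

  i≡±1⇒∣i∣≡1 : ∀ {i} → i ≡ 1ℤ ⊎ i ≡ -1ℤ → ∣ i ∣ ≡ 1
  i≡±1⇒∣i∣≡1 (inj₁ refl) = refl
  i≡±1⇒∣i∣≡1 (inj₂ refl) = refl

  sign-decomposition : ∀ i → ∃[ ε ] ∣ ε ∣ ≡ 1 × i ≡ ε * + ∣ i ∣
  sign-decomposition (+ n) = 1ℤ , refl , sym (ℤₚ.*-identityˡ (+ n))
  sign-decomposition -[1+ n ] = -1ℤ , refl , sym (ℤₚ.-1*i≡-i +[1+ n ])

  •-comm : ∀ k l v → k • l • v ≡ l • k • v
  •-comm k l v = trans (•-• k l v) (trans (cong (_• v) (ℤₚ.*-comm k l)) (sym (•-• l k v)))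

  i*i≡+∣i∣*∣i∣ : ∀ i → i * i ≡ + (∣ i ∣ ℕ.* ∣ i ∣)
  i*i≡+∣i∣*∣i∣ +0 = refl
  i*i≡+∣i∣*∣i∣ +[1+ n ] = refl
  i*i≡+∣i∣*∣i∣ -[1+ n ] = refl

  squareFree-∣ℤ-square⇒∣ℤ : ∀ {d g} x → SquareFree d → g ∣ d → + g ∣ℤ x * x → + g ∣ℤ x
  squareFree-∣ℤ-square⇒∣ℤ x sf g∣d g∣x² =
    ℤ∣.∣ᵤ⇒∣ (squareFree-∣-square⇒∣ sf g∣d (subst (_ ∣_) (ℤₚ.abs-* x x) (ℤ∣.∣⇒∣ᵤ g∣x²)))

module Quadratic (d : ℕ) where

  open import Data.Integer.Base using (_+_; _*_; _-_)
  open ℤ-Solver using (solve)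

  infixl 6 _·_
  infix 9 ‾_

  _·_ : 𝒪 → 𝒪 → 𝒪
  _·_ = mul d

  ‾_ : 𝒪 → 𝒪
  ‾_ = conj d

  -- Each coordinate identity is stated with traceω d and normω d abstracted to variables
  -- t and n, so that the ring solver can treat them as indeterminates.
  ·-comm : ∀ x y → x · y ≡ y · x
  ·-comm (a , b) (c , e) = cong₂ _,_ (first (normω d)) (second (traceω d))
    where
    first : ∀ n → a * c + b * e * n ≡ c * a + e * b * n
    first n = solve (a ∷ b ∷ c ∷ e ∷ n ∷ [])
    second : ∀ t → a * e + b * c + b * e * t ≡ c * b + e * a + e * b * t
    second t = solve (a ∷ b ∷ c ∷ e ∷ t ∷ [])

  ·-assoc : ∀ x y z → x · y · z ≡ x · (y · z)
  ·-assoc (a , b) (c , e) (f , g) = cong₂ _,_ (first (traceω d) (normω d)) (second (traceω d) (normω d))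
    where
    first : ∀ t n → (a * c + b * e * n) * f + (a * e + b * c + b * e * t) * g * n
                  ≡ a * (c * f + e * g * n) + b * (c * g + e * f + e * g * t) * n
    first t n = solve (a ∷ b ∷ c ∷ e ∷ f ∷ g ∷ t ∷ n ∷ [])
    second : ∀ t n → (a * c + b * e * n) * g + (a * e + b * c + b * e * t) * f
                       + (a * e + b * c + b * e * t) * g * t
                   ≡ a * (c * g + e * f + e * g * t) + b * (c * f + e * g * n)
                       + b * (c * g + e * f + e * g * t) * t
    second t n = solve (a ∷ b ∷ c ∷ e ∷ f ∷ g ∷ t ∷ n ∷ [])

  ι-· : ∀ k x → ι k · x ≡ k • x
  ι-· k (a , b) = cong₂ _,_ (first (normω d)) (second (traceω d))
    where
    first : ∀ n → k * a + + 0 * b * n ≡ k * a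
    first n = solve (k ∷ a ∷ b ∷ n ∷ [])
    second : ∀ t → k * b + + 0 * a + + 0 * b * t ≡ k * b
    second t = solve (k ∷ a ∷ b ∷ t ∷ [])

  conj-· : ∀ x y → ‾ (x · y) ≡ ‾ x · ‾ y
  conj-· (a , b) (c , e) = cong₂ _,_ (first (traceω d) (normω d)) (second (traceω d) (normω d))
    where
    first : ∀ t n → a * c + b * e * n + (a * e + b * c + b * e * t) * t
                  ≡ (a + b * t) * (c + e * t) + - b * - e * n
    first t n = solve (a ∷ b ∷ c ∷ e ∷ t ∷ n ∷ [])
    second : ∀ t n → - (a * e + b * c + b * e * t)
                   ≡ (a + b * t) * - e + - b * (c + e * t) + - b * - e * t
    second t n = solve (a ∷ b ∷ c ∷ e ∷ t ∷ n ∷ [])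

  conj-conj : ∀ x → ‾ ‾ x ≡ x
  conj-conj (a , b) = cong₂ _,_ (first (traceω d)) (ℤₚ.neg-involutive b)
    where
    first : ∀ t → a + b * t + - b * t ≡ a
    first t = solve (a ∷ b ∷ t ∷ [])

  conj-ι : ∀ k → ‾ ι k ≡ ι k
  conj-ι k = cong (_, + 0) (first (traceω d))
    where
    first : ∀ t → k + + 0 * t ≡ k
    first t = solve (k ∷ t ∷ [])

  ·-conj : ∀ x → x · ‾ x ≡ ι (N d x)
  ·-conj (a , b) = cong₂ _,_ (first (traceω d) (normω d)) (second (traceω d) (normω d))
    where
    first : ∀ t n → a * (a + b * t) + b * - b * n ≡ a * a + t * a * b - n * b * b
    first t n = solve (a ∷ b ∷ t ∷ n ∷ [])
    second : ∀ t n → a * - b + b * (a + b * t) + b * - b * t ≡ + 0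
    second t n = solve (a ∷ b ∷ t ∷ n ∷ [])

  N-ι : ∀ k → N d (ι k) ≡ k * k
  N-ι k = eq (traceω d) (normω d)
    where
    eq : ∀ t n → k * k + t * k * + 0 - n * + 0 * + 0 ≡ k * k
    eq t n = solve (k ∷ t ∷ n ∷ [])

  ·-isCommutativeSemigroup : IsCommutativeSemigroup _≡_ _·_
  ·-isCommutativeSemigroup = record
    { isSemigroup = record
      { isMagma = record { isEquivalence = isEquivalence ; ∙-cong = cong₂ _·_ }
      ; assoc = ·-assoc
      }
    ; comm = ·-comm
    }

  ·-commutativeSemigroup : CommutativeSemigroup _ _
  ·-commutativeSemigroup = record { isCommutativeSemigroup = ·-isCommutativeSemigroup }

  open CommutativeSemigroupProperties ·-commutativeSemigroup public using (interchange; x∙yz≈y∙xz)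

  •-· : ∀ k x y → (k • x) · y ≡ k • (x · y)
  •-· k x y = begin
    (k • x) · y   ≡⟨ cong (_· y) (ι-· k x) ⟨
    ι k · x · y   ≡⟨ ·-assoc (ι k) x y ⟩
    ι k · (x · y) ≡⟨ ι-· k (x · y) ⟩
    k • (x · y)   ∎
    where open ≡-Reasoning

  ·-• : ∀ k x y → x · (k • y) ≡ k • (x · y)
  ·-• k x y = trans (·-comm x (k • y)) (trans (•-· k y x) (cong (k •_) (·-comm y x)))

  ι-·-ι : ∀ k l → ι k · ι l ≡ ι (k * l)
  ι-·-ι k l = trans (ι-· k (ι l)) (cong (k * l ,_) (ℤₚ.*-zeroʳ k))

  conj-• : ∀ k x → ‾ (k • x) ≡ k • ‾ x
  conj-• k x = begin
    ‾ (k • x)     ≡⟨ cong ‾_ (ι-· k x) ⟨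
    ‾ (ι k · x)   ≡⟨ conj-· (ι k) x ⟩
    ‾ ι k · ‾ x   ≡⟨ cong (_· ‾ x) (conj-ι k) ⟩
    ι k · ‾ x     ≡⟨ ι-· k (‾ x) ⟩
    k • ‾ x       ∎
    where open ≡-Reasoning

  ·-conj-· : ∀ x y → x · (‾ x · y) ≡ N d x • y
  ·-conj-· x y = begin
    x · (‾ x · y)   ≡⟨ ·-assoc x (‾ x) y ⟨
    x · ‾ x · y     ≡⟨ cong (_· y) (·-conj x) ⟩
    ι (N d x) · y   ≡⟨ ι-· (N d x) y ⟩
    N d x • y       ∎
    where open ≡-Reasoning

  conj-·-· : ∀ x y → ‾ x · (x · y) ≡ N d x • y
  conj-·-· x y = trans (x∙yz≈y∙xz (‾ x) x y) (·-conj-· x y)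

  N-· : ∀ x y → N d (x · y) ≡ N d x * N d y
  N-· x y = cong proj₁ (begin
    ι (N d (x · y))             ≡⟨ ·-conj (x · y) ⟨
    x · y · ‾ (x · y)           ≡⟨ cong (x · y ·_) (conj-· x y) ⟩
    x · y · (‾ x · ‾ y)         ≡⟨ interchange x y (‾ x) (‾ y) ⟩
    x · ‾ x · (y · ‾ y)         ≡⟨ cong₂ _·_ (·-conj x) (·-conj y) ⟩
    ι (N d x) · ι (N d y)       ≡⟨ ι-·-ι (N d x) (N d y) ⟩
    ι (N d x * N d y)           ∎)
    where open ≡-Reasoning

  N-• : ∀ k x → N d (k • x) ≡ k * k * N d x
  N-• k x = begin
    N d (k • x)         ≡⟨ cong (N d) (ι-· k x) ⟨
    N d (ι k · x)       ≡⟨ N-· (ι k) x ⟩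
    N d (ι k) * N d x   ≡⟨ cong (_* N d x) (N-ι k) ⟩
    k * k * N d x       ∎
    where open ≡-Reasoning

  ∣N∣ : 𝒪 → ℕ
  ∣N∣ x = ∣ N d x ∣

  ∣N∣-· : ∀ x y → ∣N∣ (x · y) ≡ ∣N∣ x ℕ.* ∣N∣ y
  ∣N∣-· x y = trans (cong ∣_∣ (N-· x y)) (ℤₚ.abs-* (N d x) (N d y))

  ∣N∣-• : ∀ k x → ∣N∣ (k • x) ≡ ∣ k ∣ ℕ.* ∣ k ∣ ℕ.* ∣N∣ x
  ∣N∣-• k x = begin
    ∣ N d (k • x) ∣                ≡⟨ cong ∣_∣ (N-• k x) ⟩
    ∣ k * k * N d x ∣              ≡⟨ ℤₚ.abs-* (k * k) (N d x) ⟩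
    ∣ k * k ∣ ℕ.* ∣N∣ x            ≡⟨ cong (ℕ._* ∣N∣ x) (ℤₚ.abs-* k k) ⟩
    ∣ k ∣ ℕ.* ∣ k ∣ ℕ.* ∣N∣ x      ∎
    where open ≡-Reasoning

  ∣N∣-ι· : ∀ k x → ∣N∣ (ι k · x) ≡ ∣ k ∣ ℕ.* ∣ k ∣ ℕ.* ∣N∣ x
  ∣N∣-ι· k x = trans (cong ∣N∣ (ι-· k x)) (∣N∣-• k x)

  ∣N∣-unit-· : ∀ u x → IsUnit d u → ∣N∣ (u · x) ≡ ∣N∣ x
  ∣N∣-unit-· u x unit = trans (∣N∣-· u x) (trans (cong (ℕ._* ∣N∣ x) unit) (ℕₚ.*-identityˡ (∣N∣ x)))

  cont-∣-cont-· : ∀ x y → cont y ∣ cont (x · y)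
  cont-∣-cont-· (a , b) (c , e) with cont-∣ c e
  ... | g∣c , g∣e = ∣-cont
    (ℤ∣.∣m∣n⇒∣m+n (ℤ∣.∣n⇒∣m*n a g∣c) (ℤ∣.∣m⇒∣m*n (normω d) (ℤ∣.∣n⇒∣m*n b g∣e)))
    (ℤ∣.∣m∣n⇒∣m+n (ℤ∣.∣m∣n⇒∣m+n (ℤ∣.∣n⇒∣m*n a g∣e) (ℤ∣.∣n⇒∣m*n b g∣c))
                   (ℤ∣.∣m⇒∣m*n (traceω d) (ℤ∣.∣n⇒∣m*n b g∣e)))

  cont-unit-· : ∀ u y → IsUnit d u → cont (u · y) ≡ cont y
  cont-unit-· u y unit = ℕ∣.∣-antisym cont[uy]∣cont[y] (cont-∣-cont-· u y)
    where
    cont[uy]∣cont[y] : cont (u · y) ∣ cont y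
    cont[uy]∣cont[y] = subst (cont (u · y) ∣_) cont[ūuy]≡cont[y] (cont-∣-cont-· (‾ u) (u · y))
      where
      cont[ūuy]≡cont[y] : cont (‾ u · (u · y)) ≡ cont y
      cont[ūuy]≡cont[y] = begin
        cont (‾ u · (u · y))       ≡⟨ cong cont (conj-·-· u y) ⟩
        cont (N d u • y)           ≡⟨ cont-• (N d u) y ⟩
        ∣N∣ u ℕ.* cont y           ≡⟨ cong (ℕ._* cont y) unit ⟩
        1 ℕ.* cont y               ≡⟨ ℕₚ.*-identityˡ (cont y) ⟩
        cont y                     ∎
        where open ≡-Reasoning

  ∣N∣-•-unit : ∀ k x u → IsUnit d u → ∣N∣ (k • (x · u)) ≡ ∣ k ∣ ℕ.* ∣ k ∣ ℕ.* ∣N∣ x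
  ∣N∣-•-unit k x u unit = trans (∣N∣-• k (x · u))
    (cong (∣ k ∣ ℕ.* ∣ k ∣ ℕ.*_) (trans (cong ∣N∣ (·-comm x u)) (∣N∣-unit-· u x unit)))

  same-phi⇒conj : ∀ α α′ u s → α · ‾ α′ ≡ ι s · (u · u · (‾ α · α′)) →
    ‾ (‾ α · (α′ · u)) ≡ (s * N d u) • (‾ α · (α′ · u))
  same-phi⇒conj α α′ u s α·ᾱ′≡… = begin
    ‾ (‾ α · (α′ · u))                   ≡⟨ conj-· (‾ α) (α′ · u) ⟩
    ‾ ‾ α · ‾ (α′ · u)                   ≡⟨ cong₂ _·_ (conj-conj α) (conj-· α′ u) ⟩
    α · (‾ α′ · ‾ u)                     ≡⟨ ·-assoc α (‾ α′) (‾ u) ⟨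
    α · ‾ α′ · ‾ u                       ≡⟨ cong (_· ‾ u) α·ᾱ′≡… ⟩
    ι s · (u · u · X) · ‾ u              ≡⟨ cong (_· ‾ u) (ι-· s (u · u · X)) ⟩
    s • (u · u · X) · ‾ u                ≡⟨ •-· s (u · u · X) (‾ u) ⟩
    s • (u · u · X · ‾ u)                ≡⟨ cong (s •_) (·-assoc (u · u) X (‾ u)) ⟩
    s • (u · u · (X · ‾ u))              ≡⟨ cong (λ v → s • (u · u · v)) (·-comm X (‾ u)) ⟩
    s • (u · u · (‾ u · X))              ≡⟨ cong (s •_) (interchange u u (‾ u) X) ⟩
    s • (u · ‾ u · (u · X))              ≡⟨ cong (λ v → s • (v · (u · X))) (·-conj u) ⟩
    s • (ι (N d u) · (u · X))            ≡⟨ cong (s •_) (ι-· (N d u) (u · X)) ⟩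
    s • N d u • (u · X)                  ≡⟨ •-• s (N d u) (u · X) ⟩
    (s * N d u) • (u · X)                ≡⟨ cong ((s * N d u) •_) (·-comm u X) ⟩
    (s * N d u) • (X · u)                ≡⟨ cong ((s * N d u) •_) (·-assoc (‾ α) α′ u) ⟩
    (s * N d u) • (‾ α · (α′ · u))       ∎
    where
    open ≡-Reasoning
    X : 𝒪
    X = ‾ α · α′

  invariant⇒ι : ∀ x → ‾ x ≡ x → x ≡ ι (proj₁ x)
  invariant⇒ι (a , b) x̄≡x = cong (a ,_) (-i≡i⇒i≡0 (cong proj₂ x̄≡x))

  record SquareRoot : Set where
    field
      r : 𝒪
      r-visible : Visible r
      r-square : r · r ≡ ι (+ d)
      conj-r : ‾ r ≡ -1ℤ • r
      anti-invariant⇒multiple : ∀ x → ‾ x ≡ -1ℤ • x → ∃[ c ] x ≡ c • r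
      gcd-∣-cont : ∀ α → gcd (∣N∣ α) d ∣ cont (r · α)

module Fibre (d : ℕ) (nonsquare : NonSquare d) (R : Quadratic.SquareRoot d) where

  open Quadratic d
  open SquareRoot R
  open import Data.Integer.Base using (_*_; NonZero; ≢-nonZero)

  d≢0 : d ≢ 0
  d≢0 refl = nonsquare 1 0 (λ ()) refl

  d≢1 : d ≢ 1
  d≢1 refl = nonsquare 1 1 (λ ()) refl

  instance
    d-nonZero : ℕ.NonZero d
    d-nonZero = ℕ.≢-nonZero d≢0

  g : 𝒪 → ℕ
  g α = gcd (∣N∣ α) d

  ∣N∣-r : ∣N∣ r ≡ d
  ∣N∣-r = trans (cong (λ v → ∣ proj₁ v ∣) ι[Nr]≡-d) (trans (ℤₚ.abs-* -1ℤ (+ d)) (ℕₚ.*-identityˡ d))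
    where
    ι[Nr]≡-d : ι (N d r) ≡ -1ℤ • ι (+ d)
    ι[Nr]≡-d = begin
      ι (N d r)       ≡⟨ ·-conj r ⟨
      r · ‾ r         ≡⟨ cong (r ·_) conj-r ⟩
      r · (-1ℤ • r)   ≡⟨ ·-• -1ℤ r r ⟩
      -1ℤ • (r · r)   ≡⟨ cong (-1ℤ •_) r-square ⟩
      -1ℤ • ι (+ d)   ∎
      where open ≡-Reasoning

  ∣N∣-r· : ∀ α → ∣N∣ (r · α) ≡ d ℕ.* ∣N∣ α
  ∣N∣-r· α = trans (∣N∣-· r α) (cong (ℕ._* ∣N∣ α) ∣N∣-r)

  r·r· : ∀ α → r · (r · α) ≡ + d • α
  r·r· α = trans (sym (·-assoc r r α)) (trans (cong (_· α) r-square) (ι-· (+ d) α))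

  cont-r· : ∀ α → Visible α → cont (r · α) ≡ g α
  cont-r· α α-visible = ℕ∣.∣-antisym (gcd-greatest c∣∣N∣α c∣d) (gcd-∣-cont α)
    where
    c∣d : cont (r · α) ∣ d
    c∣d = subst (cont (r · α) ∣_) (trans (cong cont (r·r· α)) (cont-•-visible (+ d) α-visible))
                (cont-∣-cont-· r (r · α))
    c∣∣N∣α : cont (r · α) ∣ ∣N∣ α
    c∣∣N∣α = subst (cont (r · α) ∣_) cont[ᾱrα]≡∣N∣α (cont-∣-cont-· (‾ α) (r · α))
      where
      cont[ᾱrα]≡∣N∣α : cont (‾ α · (r · α)) ≡ ∣N∣ α
      cont[ᾱrα]≡∣N∣α = begin
        cont (‾ α · (r · α))   ≡⟨ cong (λ v → cont (‾ α · v)) (·-comm r α) ⟩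
        cont (‾ α · (α · r))   ≡⟨ cong cont (conj-·-· α r) ⟩
        cont (N d α • r)       ≡⟨ cont-•-visible (N d α) r-visible ⟩
        ∣N∣ α                  ∎
        where open ≡-Reasoning

  g≢0 : ∀ α → g α ≢ 0
  g≢0 α = gcd[m,n]≢0 (∣N∣ α) d (inj₂ d≢0)

  r·-primitive : ∀ α → Visible α → ∃[ α₀ ] Visible α₀ × r · α ≡ + g α • α₀
  r·-primitive α α-visible = subst (λ c → ∃[ α₀ ] Visible α₀ × r · α ≡ + c • α₀) (cont-r· α α-visible)
    (primitive-part (r · α) (subst (_≢ 0) (sym (cont-r· α α-visible)) (g≢0 α)))

  N≡0⇒r·-divisible : ∀ β → Visible β → N d β ≡ 0ℤ → ∃[ γ ] Visible γ × r · β ≡ + d • γ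
  N≡0⇒r·-divisible β β-visible Nβ≡0 =
    subst (λ c → ∃[ γ ] Visible γ × r · β ≡ + c • γ) gβ≡d (r·-primitive β β-visible)
    where
    gβ≡d : g β ≡ d
    gβ≡d = trans (cong (λ n → gcd ∣ n ∣ d) Nβ≡0) (gcd-identityˡ d)

  -- Descent: N α = 0 forces rα ∈ d𝒪, so α = rβ with N β = 0; repeating, α ∈ d𝒪,
  -- which is impossible for a visible α.
  visible⇒N≢0 : ∀ α → Visible α → N d α ≢ 0ℤ
  visible⇒N≢0 α α-visible Nα≡0 = descend (N≡0⇒r·-divisible α α-visible Nα≡0)
    where
    descend : ∃[ β ] Visible β × r · α ≡ + d • β → ⊥
    descend (β , β-visible , rα≡dβ) = descend′ (N≡0⇒r·-divisible β β-visible Nβ≡0)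
      where
      α≡rβ : α ≡ r · β
      α≡rβ = •-cancelˡ (+ d) (trans (sym (r·r· α)) (trans (cong (r ·_) rα≡dβ) (·-• (+ d) r β)))
      Nβ≡0 : N d β ≡ 0ℤ
      Nβ≡0 = ℤₚ.∣i∣≡0⇒i≡0 (ℕₚ.m*n≡0⇒m≡0 _ d (begin
        ∣N∣ β ℕ.* d   ≡⟨ ℕₚ.*-comm (∣N∣ β) d ⟩
        d ℕ.* ∣N∣ β   ≡⟨ ∣N∣-r· β ⟨
        ∣N∣ (r · β)   ≡⟨ cong ∣N∣ α≡rβ ⟨
        ∣N∣ α         ≡⟨ cong ∣_∣ Nα≡0 ⟩
        0             ∎))
        where open ≡-Reasoning
      descend′ : ∃[ γ ] Visible γ × r · β ≡ + d • γ → ⊥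
      descend′ (γ , γ-visible , rβ≡dγ) = d≢1 (begin
          d                 ≡⟨ cont-•-visible (+ d) γ-visible ⟨
          cont (+ d • γ)    ≡⟨ cong cont rβ≡dγ ⟨
          cont (r · β)      ≡⟨ cong cont α≡rβ ⟨
          cont α            ≡⟨ α-visible ⟩
          1                 ∎)
        where open ≡-Reasoning

  visible⇒N-nonZero : ∀ α → Visible α → NonZero (N d α)
  visible⇒N-nonZero α α-visible = ≢-nonZero (visible⇒N≢0 α α-visible)

  conj-r· : ∀ α → α · ‾ (r · α) ≡ -1ℤ • (‾ α · (r · α))
  conj-r· α = begin
    α · ‾ (r · α)             ≡⟨ cong (α ·_) (conj-· r α) ⟩
    α · (‾ r · ‾ α)           ≡⟨ cong (λ v → α · (v · ‾ α)) conj-r ⟩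
    α · (-1ℤ • r · ‾ α)       ≡⟨ cong (α ·_) (•-· -1ℤ r (‾ α)) ⟩
    α · (-1ℤ • (r · ‾ α))     ≡⟨ ·-• -1ℤ α (r · ‾ α) ⟩
    -1ℤ • (α · (r · ‾ α))     ≡⟨ cong (-1ℤ •_) (x∙yz≈y∙xz α r (‾ α)) ⟩
    -1ℤ • (r · (α · ‾ α))     ≡⟨ cong (λ v → -1ℤ • (r · v)) (·-comm α (‾ α)) ⟩
    -1ℤ • (r · (‾ α · α))     ≡⟨ cong (-1ℤ •_) (x∙yz≈y∙xz r (‾ α) α) ⟩
    -1ℤ • (‾ α · (r · α))     ∎
    where open ≡-Reasoning

  other-class : ∀ α → Visible α → Σ 𝒪 (OtherClass d α)
  other-class α α-visible = other (r·-primitive α α-visible)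
    where
    other : ∃[ α₀ ] Visible α₀ × r · α ≡ + g α • α₀ → Σ 𝒪 (OtherClass d α)
    other (α₀ , α₀-visible , rα≡gα₀) = α₀ , α₀-visible , same-phi , not-equiv
      where
      G : ℤ
      G = + g α
      same-phi : SamePhi d α α₀
      same-phi = ι 1ℤ , -1ℤ , cong ∣_∣ (N-ι 1ℤ) , inj₂ refl , •-cancelˡ G {{ℕ.≢-nonZero (g≢0 α)}} (begin
        G • (α · ‾ α₀)                          ≡⟨ ·-• G α (‾ α₀) ⟨
        α · (G • ‾ α₀)                          ≡⟨ cong (α ·_) (conj-• G α₀) ⟨
        α · ‾ (G • α₀)                          ≡⟨ cong (λ v → α · ‾ v) rα≡gα₀ ⟨
        α · ‾ (r · α)                           ≡⟨ conj-r· α ⟩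
        -1ℤ • (‾ α · (r · α))                   ≡⟨ cong (λ v → -1ℤ • (‾ α · v)) rα≡gα₀ ⟩
        -1ℤ • (‾ α · (G • α₀))                  ≡⟨ cong (-1ℤ •_) (·-• G (‾ α) α₀) ⟩
        -1ℤ • G • (‾ α · α₀)                    ≡⟨ •-comm -1ℤ G (‾ α · α₀) ⟩
        G • -1ℤ • (‾ α · α₀)                    ≡⟨ cong (G •_) (ι-· -1ℤ (‾ α · α₀)) ⟨
        G • (ι -1ℤ · (‾ α · α₀))                ≡⟨ cong (λ v → G • (ι -1ℤ · v)) ι1·ι1·x≡x ⟨
        G • (ι -1ℤ · (ι 1ℤ · ι 1ℤ · (‾ α · α₀))) ∎)
        where
        open ≡-Reasoning
        ι1·ι1·x≡x : ι 1ℤ · ι 1ℤ · (‾ α · α₀) ≡ ‾ α · α₀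
        ι1·ι1·x≡x = trans (cong (_· (‾ α · α₀)) (ι-·-ι 1ℤ 1ℤ)) (trans (ι-· 1ℤ _) (•-identityˡ _))
      not-equiv : ¬ Equiv d α α₀
      not-equiv (υ , m , n , υ-unit , m≢0 , _ , υmα₀≡nα) =
        nonsquare m (g α ℕ.* n) (ℕ.≢-nonZero⁻¹ m {{m≢0}})
          (m²b≡n²a∧k²b≡la⇒m²l≡[kn]² {A} {B} {m} {n} {g α} {d} {{visible⇒N-nonZero α α-visible}} m²B≡n²A g²B≡dA)
        where
        open ≡-Reasoning
        A : ℕ
        A = ∣N∣ α
        B : ℕ
        B = ∣N∣ α₀
        m²B≡n²A : m ℕ.* m ℕ.* B ≡ n ℕ.* n ℕ.* A
        m²B≡n²A = begin
          m ℕ.* m ℕ.* B                   ≡⟨ ∣N∣-ι· (+ m) α₀ ⟨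
          ∣N∣ (ι (+ m) · α₀)              ≡⟨ ∣N∣-unit-· υ (ι (+ m) · α₀) υ-unit ⟨
          ∣N∣ (υ · (ι (+ m) · α₀))        ≡⟨ cong ∣N∣ υmα₀≡nα ⟩
          ∣N∣ (ι (+ n) · α)               ≡⟨ ∣N∣-ι· (+ n) α ⟩
          n ℕ.* n ℕ.* A                   ∎
        g²B≡dA : g α ℕ.* g α ℕ.* B ≡ d ℕ.* A
        g²B≡dA = begin
          g α ℕ.* g α ℕ.* B               ≡⟨ ∣N∣-• G α₀ ⟨
          ∣N∣ (G • α₀)                    ≡⟨ cong ∣N∣ rα≡gα₀ ⟨
          ∣N∣ (r · α)                     ≡⟨ ∣N∣-r· α ⟩
          d ℕ.* A                         ∎

  -- Multiplying by l makes the coefficient of γ the positive integer l², and the sign of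
  -- l k is absorbed into the unit.
  scaled⇒Equiv : ∀ γ γ′ u k l .{{_ : NonZero k}} .{{_ : NonZero l}} →
    IsUnit d u → k • (γ′ · u) ≡ l • γ → Equiv d γ γ′
  scaled⇒Equiv γ γ′ u k l u-unit kγ′u≡lγ = equiv (sign-decomposition (l * k))
    where
    equiv : ∃[ ε ] ∣ ε ∣ ≡ 1 × l * k ≡ ε * + ∣ l * k ∣ → Equiv d γ γ′
    equiv (ε , ∣ε∣≡1 , lk≡ε∣lk∣) =
      ε • u , ∣ l * k ∣ , ∣ l ∣ ℕ.* ∣ l ∣ , εu-unit , ℤₚ.i*j≢0 l k , ℕₚ.m*n≢0 ∣ l ∣ ∣ l ∣ , (begin
        ε • u · (ι K · γ′)               ≡⟨ cong (ε • u ·_) (ι-· K γ′) ⟩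
        ε • u · (K • γ′)                 ≡⟨ •-· ε u (K • γ′) ⟩
        ε • (u · (K • γ′))               ≡⟨ cong (ε •_) (·-• K u γ′) ⟩
        ε • K • (u · γ′)                 ≡⟨ •-• ε K (u · γ′) ⟩
        (ε * K) • (u · γ′)               ≡⟨ cong₂ _•_ lk≡ε∣lk∣ (·-comm γ′ u) ⟨
        (l * k) • (γ′ · u)               ≡⟨ •-• l k (γ′ · u) ⟨
        l • k • (γ′ · u)                 ≡⟨ cong (l •_) kγ′u≡lγ ⟩
        l • l • γ                        ≡⟨ •-• l l γ ⟩
        (l * l) • γ                      ≡⟨ cong (_• γ) (i*i≡+∣i∣*∣i∣ l) ⟩
        + (∣ l ∣ ℕ.* ∣ l ∣) • γ          ≡⟨ ι-· (+ (∣ l ∣ ℕ.* ∣ l ∣)) γ ⟨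
        ι (+ (∣ l ∣ ℕ.* ∣ l ∣)) · γ      ∎)
      where
      open ≡-Reasoning
      K : ℤ
      K = + ∣ l * k ∣
      εu-unit : IsUnit d (ε • u)
      εu-unit = trans (∣N∣-• ε u) (cong₂ (λ e n → e ℕ.* e ℕ.* n) ∣ε∣≡1 u-unit)

  invariant⇒Equiv : ∀ α α′ u → Visible α → Visible α′ → IsUnit d u →
    ‾ (‾ α · (α′ · u)) ≡ ‾ α · (α′ · u) → Equiv d α α′
  invariant⇒Equiv α α′ u α-visible α′-visible u-unit δ-invariant =
    scaled⇒Equiv α α′ u (N d α) x {{Nα≢0}} {{x≢0}} u-unit Nα•α′u≡xα
    where
    x : ℤ
    x = proj₁ (‾ α · (α′ · u))
    Nα≢0 : NonZero (N d α)
    Nα≢0 = visible⇒N-nonZero α α-visible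
    Nα•α′u≡xα : N d α • (α′ · u) ≡ x • α
    Nα•α′u≡xα = begin
      N d α • (α′ · u)          ≡⟨ ·-conj-· α (α′ · u) ⟨
      α · (‾ α · (α′ · u))      ≡⟨ cong (α ·_) (invariant⇒ι _ δ-invariant) ⟩
      α · ι x                   ≡⟨ ·-comm α (ι x) ⟩
      ι x · α                   ≡⟨ ι-· x α ⟩
      x • α                     ∎
      where open ≡-Reasoning
    x≢0 : NonZero x
    x≢0 = ≢-nonZero {x} λ x≡0 → ℕ.≢-nonZero⁻¹ _ {{∣N∣≢0}} (begin
      ∣N∣ (N d α • (α′ · u))    ≡⟨ cong ∣N∣ Nα•α′u≡xα ⟩
      ∣N∣ (x • α)               ≡⟨ cong (λ k → ∣N∣ (k • α)) x≡0 ⟩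
      ∣N∣ (0ℤ • α)              ≡⟨ ∣N∣-• 0ℤ α ⟩
      0                         ∎)
      where
      open ≡-Reasoning
      ∣N∣≢0 : ℕ.NonZero (∣N∣ (N d α • (α′ · u)))
      ∣N∣≢0 = subst ℕ.NonZero (sym (∣N∣-•-unit (N d α) α′ u u-unit))
        (ℕₚ.m*n≢0 _ _ {{ℕₚ.m*n≢0 _ _ {{Nα≢0}} {{Nα≢0}}}} {{visible⇒N-nonZero α′ α′-visible}})

  anti-invariant⇒norm-product : ∀ α α′ u → Visible α → Visible α′ → IsUnit d u →
    ‾ (‾ α · (α′ · u)) ≡ -1ℤ • (‾ α · (α′ · u)) →
    ∣N∣ α ℕ.* ∣N∣ α′ ℕ.* (g α ℕ.* g α) ≡ d ℕ.* (∣N∣ α ℕ.* ∣N∣ α)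
  anti-invariant⇒norm-product α α′ u α-visible α′-visible u-unit δ-anti-invariant =
    by-multiple (anti-invariant⇒multiple _ δ-anti-invariant)
    where
    A : ℕ
    A = ∣N∣ α
    A′ : ℕ
    A′ = ∣N∣ α′
    by-multiple : ∃[ c ] ‾ α · (α′ · u) ≡ c • r → A ℕ.* A′ ℕ.* (g α ℕ.* g α) ≡ d ℕ.* (A ℕ.* A)
    by-multiple (c , δ≡cr) =
      m≡kg∧m²n≡k²dm⇒mng²≡dm² {A} {A′} {∣ c ∣} {g α} {d} {{visible⇒N-nonZero α α-visible}}
        A≡∣c∣g A²A′≡c²dA
      where
      open ≡-Reasoning
      Nα•α′u≡c•rα : N d α • (α′ · u) ≡ c • (r · α)
      Nα•α′u≡c•rα = begin
        N d α • (α′ · u)          ≡⟨ ·-conj-· α (α′ · u) ⟨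
        α · (‾ α · (α′ · u))      ≡⟨ cong (α ·_) δ≡cr ⟩
        α · (c • r)               ≡⟨ ·-• c α r ⟩
        c • (α · r)               ≡⟨ cong (c •_) (·-comm α r) ⟩
        c • (r · α)               ∎
      A≡∣c∣g : A ≡ ∣ c ∣ ℕ.* g α
      A≡∣c∣g = begin
        A                         ≡⟨ cont-•-visible (N d α) (trans (cont-unit-· u α′ u-unit) α′-visible) ⟨
        cont (N d α • (u · α′))   ≡⟨ cong (λ v → cont (N d α • v)) (·-comm u α′) ⟩
        cont (N d α • (α′ · u))   ≡⟨ cong cont Nα•α′u≡c•rα ⟩
        cont (c • (r · α))        ≡⟨ cont-• c (r · α) ⟩
        ∣ c ∣ ℕ.* cont (r · α)    ≡⟨ cong (∣ c ∣ ℕ.*_) (cont-r· α α-visible) ⟩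
        ∣ c ∣ ℕ.* g α             ∎
      A²A′≡c²dA : A ℕ.* A ℕ.* A′ ≡ ∣ c ∣ ℕ.* ∣ c ∣ ℕ.* (d ℕ.* A)
      A²A′≡c²dA = begin
        A ℕ.* A ℕ.* A′                   ≡⟨ ∣N∣-•-unit (N d α) α′ u u-unit ⟨
        ∣N∣ (N d α • (α′ · u))           ≡⟨ cong ∣N∣ Nα•α′u≡c•rα ⟩
        ∣N∣ (c • (r · α))                ≡⟨ ∣N∣-• c (r · α) ⟩
        ∣ c ∣ ℕ.* ∣ c ∣ ℕ.* ∣N∣ (r · α)  ≡⟨ cong (∣ c ∣ ℕ.* ∣ c ∣ ℕ.*_) (∣N∣-r· α) ⟩
        ∣ c ∣ ℕ.* ∣ c ∣ ℕ.* (d ℕ.* A)    ∎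

  norm-product : ∀ α α′ → Visible α → OtherClass d α α′ →
    ∣N∣ α ℕ.* ∣N∣ α′ ℕ.* (g α ℕ.* g α) ≡ d ℕ.* (∣N∣ α ℕ.* ∣N∣ α)
  norm-product α α′ α-visible (α′-visible , (u , s , u-unit , s≡±1 , α·ᾱ′≡…) , not-equiv) =
    by-sign (∣i∣≡1⇒i≡±1 (trans (ℤₚ.abs-* s (N d u)) (cong₂ ℕ._*_ (i≡±1⇒∣i∣≡1 s≡±1) u-unit)))
    where
    δ : 𝒪
    δ = ‾ α · (α′ · u)
    by-sign : s * N d u ≡ 1ℤ ⊎ s * N d u ≡ -1ℤ →
      ∣N∣ α ℕ.* ∣N∣ α′ ℕ.* (g α ℕ.* g α) ≡ d ℕ.* (∣N∣ α ℕ.* ∣N∣ α)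
    by-sign (inj₁ sNu≡1) = ⊥-elim (not-equiv (invariant⇒Equiv α α′ u α-visible α′-visible u-unit
      (trans (same-phi⇒conj α α′ u s α·ᾱ′≡…) (trans (cong (_• δ) sNu≡1) (•-identityˡ δ)))))
    by-sign (inj₂ sNu≡-1) = anti-invariant⇒norm-product α α′ u α-visible α′-visible u-unit
      (trans (same-phi⇒conj α α′ u s α·ᾱ′≡…) (cong (_• δ) sNu≡-1))

module _ {d : ℕ} (sf : SquareFree d) where

  open import Data.Integer.Base using (_+_; _*_; _-_)
  open ℤ-Solver using (solve)

  open Quadratic d

  gcd[N,d]∣N : ∀ α → + gcd (∣N∣ α) d ∣ℤ N d α
  gcd[N,d]∣N α = ℤ∣.∣ᵤ⇒∣ (gcd[m,n]∣m (∣N∣ α) d)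

  gcd[N,d]∣d : ∀ α → + gcd (∣N∣ α) d ∣ℤ + d
  gcd[N,d]∣d α = ℤ∣.∣ᵤ⇒∣ (gcd[m,n]∣n (∣N∣ α) d)

  √d≡ω : traceω d ≡ 0ℤ → normω d ≡ + d → SquareRoot
  √d≡ω t≡0 n≡d = record
    { r = ω
    ; r-visible = refl
    ; r-square = trans (ω· 0ℤ 1ℤ) (cong (_, 0ℤ) (ℤₚ.*-identityˡ (+ d)))
    ; conj-r = cong (_, -1ℤ) (cong (λ t → 0ℤ + 1ℤ * t) t≡0)
    ; anti-invariant⇒multiple = anti-invariant⇒multiple
    ; gcd-∣-cont = gcd-∣-cont
    }
    where
    ω : 𝒪
    ω = 0ℤ , 1ℤ
    ω· : ∀ a b → ω · (a , b) ≡ (b * + d , a)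
    ω· a b = cong₂ _,_ (trans (first (normω d)) (cong (b *_) n≡d)) (second (traceω d) t≡0)
      where
      first : ∀ n → 0ℤ * a + 1ℤ * b * n ≡ b * n
      first n = solve (a ∷ b ∷ n ∷ [])
      second : ∀ t → t ≡ 0ℤ → 0ℤ * b + 1ℤ * a + 1ℤ * b * t ≡ a
      second _ refl = solve (a ∷ b ∷ [])
    anti-invariant⇒multiple : ∀ x → ‾ x ≡ -1ℤ • x → ∃[ c ] x ≡ c • ω
    anti-invariant⇒multiple (a , b) x̄≡-x =
      b , cong₂ _,_ (trans a≡0 (sym (ℤₚ.*-zeroʳ b))) (sym (ℤₚ.*-identityʳ b))
      where
      a≡0 : a ≡ 0ℤ
      a≡0 = -i≡i⇒i≡0 (begin
        - a                ≡⟨ ℤₚ.-1*i≡-i a ⟨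
        -1ℤ * a            ≡⟨ cong proj₁ x̄≡-x ⟨
        a + b * traceω d   ≡⟨ cong (λ t → a + b * t) t≡0 ⟩
        a + b * 0ℤ         ≡⟨ solve (a ∷ b ∷ []) ⟩
        a                  ∎)
        where open ≡-Reasoning
    gcd-∣-cont : ∀ α → gcd (∣N∣ α) d ∣ cont (ω · α)
    gcd-∣-cont (a , b) = subst (λ v → G ∣ cont v) (sym (ω· a b)) (∣-cont (ℤ∣.∣n⇒∣m*n b G∣d) G∣a)
      where
      G : ℕ
      G = gcd (∣N∣ (a , b)) d
      G∣d : + G ∣ℤ + d
      G∣d = gcd[N,d]∣d (a , b)
      a²≡N+db² : a * a ≡ N d (a , b) + + d * (b * b)
      a²≡N+db² = trans (identity (traceω d) (normω d) t≡0) (cong (λ n → N d (a , b) + n * (b * b)) n≡d)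
        where
        identity : ∀ t n → t ≡ 0ℤ → a * a ≡ (a * a + t * a * b - n * b * b) + n * (b * b)
        identity _ n refl = solve (a ∷ b ∷ n ∷ [])
      G∣a : + G ∣ℤ a
      G∣a = squareFree-∣ℤ-square⇒∣ℤ a sf (gcd[m,n]∣n (∣N∣ (a , b)) d) (subst (+ G ∣ℤ_) (sym a²≡N+db²)
        (ℤ∣.∣m∣n⇒∣m+n (gcd[N,d]∣N (a , b)) (ℤ∣.∣m⇒∣m*n (b * b) G∣d)))

  √d≡2ω-1 : traceω d ≡ 1ℤ → + d ≡ + 4 * normω d + 1ℤ → SquareRoot
  √d≡2ω-1 t≡1 d≡4n+1 = record
    { r = ρ
    ; r-visible = refl
    ; r-square = cong₂ _,_ (trans (ℤₚ.+-comm 1ℤ (+ 4 * normω d)) (sym d≡4n+1))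
                           (cong (λ t → -1ℤ * + 2 + + 2 * -1ℤ + + 2 * + 2 * t) t≡1)
    ; conj-r = cong (_, - + 2) (cong (λ t → -1ℤ + + 2 * t) t≡1)
    ; anti-invariant⇒multiple = anti-invariant⇒multiple
    ; gcd-∣-cont = gcd-∣-cont
    }
    where
    ρ : 𝒪
    ρ = -1ℤ , + 2
    ρ· : ∀ a b → ρ · (a , b) ≡ (+ 2 * b * normω d - a , + 2 * a + b)
    ρ· a b = cong₂ _,_ (first (normω d)) (second (traceω d) t≡1)
      where
      first : ∀ n → -1ℤ * a + + 2 * b * n ≡ + 2 * b * n - a
      first n = solve (a ∷ b ∷ n ∷ [])
      second : ∀ t → t ≡ 1ℤ → -1ℤ * b + + 2 * a + + 2 * b * t ≡ + 2 * a + b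
      second _ refl = solve (a ∷ b ∷ [])
    anti-invariant⇒multiple : ∀ x → ‾ x ≡ -1ℤ • x → ∃[ c ] x ≡ c • ρ
    anti-invariant⇒multiple (a , b) x̄≡-x = - a , cong₂ _,_ (solve (a ∷ [])) (begin
      b                  ≡⟨ solve (a ∷ b ∷ []) ⟩
      a + b * 1ℤ - a     ≡⟨ cong (λ t → a + b * t - a) t≡1 ⟨
      a + b * traceω d - a ≡⟨ cong (_- a) (cong proj₁ x̄≡-x) ⟩
      -1ℤ * a - a        ≡⟨ solve (a ∷ []) ⟩
      - a * + 2          ∎)
      where open ≡-Reasoning
    gcd-∣-cont : ∀ α → gcd (∣N∣ α) d ∣ cont (ρ · α)
    gcd-∣-cont (a , b) = subst (λ v → G ∣ cont v) (sym (ρ· a b)) (∣-cont G∣x G∣y)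
      where
      G : ℕ
      G = gcd (∣N∣ (a , b)) d
      x : ℤ
      x = + 2 * b * normω d - a
      y : ℤ
      y = + 2 * a + b
      G∣d : + G ∣ℤ + d
      G∣d = gcd[N,d]∣d (a , b)
      y²≡4N+db² : y * y ≡ + 4 * N d (a , b) + + d * (b * b)
      y²≡4N+db² = trans (identity (traceω d) (normω d) t≡1)
                        (cong (λ e → + 4 * N d (a , b) + e * (b * b)) (sym d≡4n+1))
        where
        identity : ∀ t n → t ≡ 1ℤ →
          (+ 2 * a + b) * (+ 2 * a + b)
            ≡ + 4 * (a * a + t * a * b - n * b * b) + (+ 4 * n + 1ℤ) * (b * b)
        identity _ n refl = solve (a ∷ b ∷ n ∷ [])
      G∣y : + G ∣ℤ y
      G∣y = squareFree-∣ℤ-square⇒∣ℤ y sf (gcd[m,n]∣n (∣N∣ (a , b)) d) (subst (+ G ∣ℤ_) (sym y²≡4N+db²)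
        (ℤ∣.∣m∣n⇒∣m+n (ℤ∣.∣n⇒∣m*n (+ 4) (gcd[N,d]∣N (a , b))) (ℤ∣.∣m⇒∣m*n (b * b) G∣d)))
      -- G ∣ d is odd, so G ∣ 2x = b d − y gives G ∣ x; this identity performs the halving.
      x≡xd-2n[bd-y] : x ≡ x * + d - + 2 * normω d * (b * + d - y)
      x≡xd-2n[bd-y] = trans (identity (normω d))
                            (cong (λ e → x * e - + 2 * normω d * (b * e - y)) (sym d≡4n+1))
        where
        identity : ∀ n → + 2 * b * n - a
          ≡ (+ 2 * b * n - a) * (+ 4 * n + 1ℤ) - + 2 * n * (b * (+ 4 * n + 1ℤ) - (+ 2 * a + b))
        identity n = solve (a ∷ b ∷ n ∷ [])
      G∣x : + G ∣ℤ x
      G∣x = subst (+ G ∣ℤ_) (sym x≡xd-2n[bd-y]) (ℤ∣.∣m∣n⇒∣m-n (ℤ∣.∣n⇒∣m*n x G∣d)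
        (ℤ∣.∣n⇒∣m*n (+ 2 * normω d) (ℤ∣.∣m∣n⇒∣m-n (ℤ∣.∣n⇒∣m*n b G∣d) G∣y)))

open import Data.Nat.Base using (_+_; _*_; _∸_; _<_)

m%4≡1⇒m≡4[[m∸1]/4]+1 : ∀ m → m % 4 ≡ 1 → m ≡ 4 * ((m ∸ 1) / 4) + 1
m%4≡1⇒m≡4[[m∸1]/4]+1 m m%4≡1 = begin
  m                       ≡⟨ m≡1+q*4 ⟩
  1 + m / 4 * 4           ≡⟨ ℕₚ.+-comm 1 (m / 4 * 4) ⟩
  m / 4 * 4 + 1           ≡⟨ cong (_+ 1) (ℕₚ.*-comm (m / 4) 4) ⟩
  4 * (m / 4) + 1         ≡⟨ cong (λ q → 4 * q + 1) (m*n/n≡m (m / 4) 4) ⟨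
  4 * (m / 4 * 4 / 4) + 1 ≡⟨ cong (λ n → 4 * ((n ∸ 1) / 4) + 1) m≡1+q*4 ⟨
  4 * ((m ∸ 1) / 4) + 1   ∎
  where
  open ≡-Reasoning
  m≡1+q*4 : m ≡ 1 + m / 4 * 4
  m≡1+q*4 = trans (m≡m%n+[m/n]*n m 4) (cong (_+ m / 4 * 4) m%4≡1)

ω²≡d : ∀ {d} k → d % 4 ≡ 2 + k → traceω d ≡ 0ℤ × normω d ≡ + d
ω²≡d k d%4≡2+k rewrite d%4≡2+k = refl , refl

ω²≡ω+n : ∀ {d} → d % 4 ≡ 1 → traceω d ≡ 1ℤ × + d ≡ + 4 ℤ.* normω d ℤ.+ 1ℤ
ω²≡ω+n {d} d%4≡1 rewrite d%4≡1 = refl , (begin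
  + d                             ≡⟨ cong +_ (m%4≡1⇒m≡4[[m∸1]/4]+1 d d%4≡1) ⟩
  + (4 * q + 1)                   ≡⟨ ℤₚ.pos-+ (4 * q) 1 ⟩
  + (4 * q) ℤ.+ 1ℤ                ≡⟨ cong (ℤ._+ 1ℤ) (ℤₚ.pos-* 4 q) ⟩
  + 4 ℤ.* + q ℤ.+ 1ℤ              ∎)
  where
  open ≡-Reasoning
  q : ℕ
  q = (d ∸ 1) / 4

squareRoot : ∀ {d} → SquareFree d → Quadratic.SquareRoot d
squareRoot {d} sf = by-residue (d % 4) refl
  where
  by-residue : ∀ k → d % 4 ≡ k → Quadratic.SquareRoot d
  by-residue 0 d%4≡0 with sf 2 (m%n≡0⇒n∣m d 4 d%4≡0)
  ... | ()
  by-residue 1 d%4≡1 = let t≡1 , d≡4n+1 = ω²≡ω+n d%4≡1 in √d≡2ω-1 sf t≡1 d≡4n+1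
  by-residue (suc (suc k)) d%4≡2+k = let t≡0 , n≡d = ω²≡d k d%4≡2+k in √d≡ω sf t≡0 n≡d

lemma6 : (d : ℕ) → 1 < d → SquareFree d →
    (α : 𝒪) → Visible α →
    Σ 𝒪 (OtherClass d α) ×
    ((α' : 𝒪) → OtherClass d α α' →
      ∣ N d α ∣ * ∣ N d α' ∣ * (gcd (∣ N d α ∣) d * gcd (∣ N d α ∣) d)
        ≡ d * (∣ N d α ∣ * ∣ N d α ∣))
lemma6 d 1<d sf α α-visible = other-class α α-visible , λ α′ → norm-product α α′ α-visible
  where open Fibre d (squareFree⇒nonSquare sf 1<d) (squareRoot sf)
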